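{- Let $k\geq 2$ be an integer and let $D=(V,A)$ be the digraph defined below. Then there do not exist an $s\to t$ path and a $t\to s$ path in $D$ which are edge-disjoint. Construction: Let $I=\{0,\dots,2k-1\}$, $I_e=\{i\in I: i \text{ even}\}$, $I_o=I\setminus I_e$, and let $I^*$ be the set of finite sequences of elements of $I$ (including the empty sequence); concatenation of sequences is written by juxtaposition. The vertex set is $V=\{s_\mu:\mu\in I^*\}\cup\{t_\mu:\mu\in I^*\}$, all these vertices being pairwise distinct; write $s,t$ for $s_\mu,t_\mu$ when $\mu$ is empty. The (multi)edge set $A$ consists of: for every $\mu\in I^*$, exactly $k$ parallel edges in each direction between the two vertices of each of the pairs $\{s_\mu,t_{\mu1}\}$, $\{s_{\mu i},t_{\mu(i+2)}\}$ for $i=0,\dots,2k-3$, and $\{s_{\mu(2k-2)},t_\mu\}$; and, for every $\mu\in I^*$, the single directed edges $(s_\mu,t_{\mu0})$, $(t_{\mu i},s_{\mu(i+1)})$ for $i\in I_e$, $(s_{\mu i},t_{\mu(i+1)})$ for $i\in I_o\setminus\{2k-1\}$, and $(s_{\mu(2k-1)},t_\mu)$.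
   Context: All paths are finite, simple, directed paths; a $u\to v$ path is a path with initial vertex $u$ and terminal vertex $v$. Two paths are edge-disjoint if they share no edge (parallel edges count as distinct edges). -}

module Defs where

open import Data.Nat using (ℕ; zero; suc; _+_; _*_; _∸_; _≤_; _<_; z≤n; s≤s)
open import Data.Nat.Properties
open import Data.Fin using (Fin; toℕ; fromℕ<)
open import Data.Fin.Properties using (toℕ<n)
open import Data.Bool using (Bool; true; false)
open import Data.List using (List; []; _∷_; _++_; [_])
open import Data.List.Membership.Propositional using (_∈_)
open import Data.List.Relation.Unary.Unique.Propositional using (Unique)
open import Data.Empty using (⊥)
open import Relation.Binary.PropositionalEquality using (_≡_; refl; sym; trans; cong; subst)

private
  lt+ : ∀ a b n → a < n ∸ b → a + b < n
  lt+ a zero n p = subst (_< n) (sym (+-identityʳ a)) p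
  lt+ a (suc b) zero ()
  lt+ a (suc b) (suc n) p = subst (_< suc n) (sym (+-suc a b)) (s≤s (lt+ a b n p))

  sub< : ∀ n b → 0 < b → b ≤ n → n ∸ b < n
  sub< n b p q = ∸-monoʳ-< {n} {b} {0} p q

  two≤2k : ∀ k → 2 ≤ k → 2 ≤ 2 * k
  two≤2k k hk = ≤-trans hk (m≤n*m k 2)

  ev : ∀ k j → j < k → suc (suc (2 * j)) ≤ 2 * k
  ev k j p = subst (_≤ 2 * k) (*-suc 2 j) (*-monoʳ-≤ 2 p)

  od : ∀ k j → j < k ∸ 1 → suc (suc (suc (suc (2 * j)))) ≤ 2 * k
  od k j p = subst (_≤ 2 * k) eq (*-monoʳ-≤ 2 q)
    where
    q : suc (suc j) ≤ k
    q = subst (λ x → suc x ≤ k) (+-comm j 1) (lt+ j 1 k p)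
    eq : 2 * suc (suc j) ≡ suc (suc (suc (suc (2 * j))))
    eq = trans (*-suc 2 (suc j)) (cong (λ x → suc (suc x)) (*-suc 2 j))

I : ℕ → Set
I k = Fin (2 * k)

-- I* : finite sequences over I; concatenation is _++_, and μi is μ ++ [ i ].
Word : ℕ → Set
Word k = List (I k)

data Vertex (k : ℕ) : Set where
  s : Word k → Vertex k
  t : Word k → Vertex k

-- For the k parallel edges in each direction of a pair {x,y}:
-- the Fin k argument numbers the parallel copy, and the Bool
-- gives the direction (true : s-vertex → t-vertex, false : t-vertex → s-vertex).
data Arc (k : ℕ) : Set where
  pairA : (μ : Word k) → Fin k → Bool → Arc k
  pairB : (μ : Word k) → (i : Fin (2 * k ∸ 2)) → Fin k → Bool → Arc k
  pairC : (μ : Word k) → Fin k → Bool → Arc k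
  arc1 : (μ : Word k) → Arc k
  -- (t_μi , s_μ(i+1)) for i = 2j ∈ I_e, j = 0, …, k-1
  arc2 : (μ : Word k) → (j : Fin k) → Arc k
  -- (s_μi , t_μ(i+1)) for i = 2j+1 ∈ I_o ∖ {2k-1}, j = 0, …, k-2
  arc3 : (μ : Word k) → (j : Fin (k ∸ 1)) → Arc k
  arc4 : (μ : Word k) → Arc k

module _ (k : ℕ) (hk : 2 ≤ k) where

  private
    n = 2 * k
    i0 : I k
    i0 = fromℕ< {0} (≤-trans (s≤s z≤n) (two≤2k k hk))
    i1 : I k
    i1 = fromℕ< {1} (two≤2k k hk)
    i2k-2 : I k
    i2k-2 = fromℕ< {n ∸ 2} (sub< n 2 (s≤s z≤n) (two≤2k k hk))
    i2k-1 : I k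
    i2k-1 = fromℕ< {n ∸ 1} (sub< n 1 (s≤s z≤n) (≤-trans (s≤s z≤n) (two≤2k k hk)))
    iB : Fin (n ∸ 2) → I k
    iB i = fromℕ< {toℕ i} (≤-trans (s≤s (m≤m+n (toℕ i) 2)) (lt+ (toℕ i) 2 n (toℕ<n i)))
    iB+2 : Fin (n ∸ 2) → I k
    iB+2 i = fromℕ< {toℕ i + 2} (lt+ (toℕ i) 2 n (toℕ<n i))
    ie : Fin k → I k
    ie j = fromℕ< {2 * toℕ j} (≤-trans (n≤1+n _) (ev k (toℕ j) (toℕ<n j)))
    ie+1 : Fin k → I k
    ie+1 j = fromℕ< {suc (2 * toℕ j)} (ev k (toℕ j) (toℕ<n j))
    io : Fin (k ∸ 1) → I k
    io j = fromℕ< {suc (2 * toℕ j)}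
             (≤-trans (n≤1+n _) (≤-trans (n≤1+n _) (od k (toℕ j) (toℕ<n j))))
    io+1 : Fin (k ∸ 1) → I k
    io+1 j = fromℕ< {suc (suc (2 * toℕ j))} (≤-trans (n≤1+n _) (od k (toℕ j) (toℕ<n j)))

    _·_ : Word k → I k → Word k
    μ · i = μ ++ [ i ]

    dirSrc dirTgt : Bool → Vertex k → Vertex k → Vertex k
    dirSrc true  x y = x
    dirSrc false x y = y
    dirTgt true  x y = y
    dirTgt false x y = x

  src : Arc k → Vertex k
  src (pairA μ _ d)   = dirSrc d (s μ) (t (μ · i1))
  src (pairB μ i _ d) = dirSrc d (s (μ · iB i)) (t (μ · iB+2 i))
  src (pairC μ _ d)   = dirSrc d (s (μ · i2k-2)) (t μ)
  src (arc1 μ)        = s μ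
  src (arc2 μ j)      = t (μ · ie j)
  src (arc3 μ j)      = s (μ · io j)
  src (arc4 μ)        = s (μ · i2k-1)

  tgt : Arc k → Vertex k
  tgt (pairA μ _ d)   = dirTgt d (s μ) (t (μ · i1))
  tgt (pairB μ i _ d) = dirTgt d (s (μ · iB i)) (t (μ · iB+2 i))
  tgt (pairC μ _ d)   = dirTgt d (s (μ · i2k-2)) (t μ)
  tgt (arc1 μ)        = t (μ · i0)
  tgt (arc2 μ j)      = s (μ · ie+1 j)
  tgt (arc3 μ j)      = t (μ · io+1 j)
  tgt (arc4 μ)        = t μ

  data Walk : Vertex k → Vertex k → Set where
    []  : ∀ {u} → Walk u u
    _∷_ : (a : Arc k) → ∀ {v} → Walk (tgt a) v → Walk (src a) v

  vertices : ∀ {u v} → Walk u v → List (Vertex k)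
  vertices {u} []  = u ∷ []
  vertices (a ∷ w) = src a ∷ vertices w

  arcs : ∀ {u v} → Walk u v → List (Arc k)
  arcs []      = []
  arcs (a ∷ w) = a ∷ arcs w

  IsPath : ∀ {u v} → Walk u v → Set
  IsPath w = Unique (vertices w)

  -- Edge-disjoint: no arc (parallel arcs being distinct) used by both.
  EdgeDisjoint : ∀ {u v x y} → Walk u v → Walk x y → Set
  EdgeDisjoint p q = ∀ a → a ∈ arcs p → a ∈ arcs q → ⊥

module Submission where

-- Every μ ∈ I* has a gadget: the vertices s_μ, t_μ and s_μi, t_μi for the
-- children μi.  Give them levels (s_μ: 0, t_μ: k, t_μi: ⌊i/2⌋, s_μi: ⌊i/2⌋+1) and parities
-- (s_μ odd, t_μ even, s_μi and t_μi that of i).  Arcs never lower the level; the only arcs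
-- raising it, and the only arcs from an even to an odd vertex, are (t_μ2j, s_μ(2j+1)).
-- A simple walk that stays in the subtree of μ and joins two gadget vertices of μ splits
-- into hops: arcs of the gadget, and passages through the subtree of a child μi between
-- s_μi and t_μi (one level down from s_μi to t_μi, one level up the other way).
-- If P : s_μ → t_μ and Q : t_μ → s_μ are such walks with disjoint arcs, then Q turns odd
-- at some arc (t_μ2j, s_μ(2j+1)), so it descends to level ≤ j twice, through the two
-- children 2j and 2j+1 of that level; P climbs above level j, and as it cannot use the
-- same arc, it does so through one of these two children.  That child again carries such
-- a pair of walks, with the roles exchanged, and since the words along P and Q have
-- bounded length this descent is impossible.

open import Defs
open import Data.Nat using (ℕ; zero; suc; _+_; _*_; _∸_; _≤_; _<_; z≤n; s≤s; _≤?_; ⌊_/2⌋; parity)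
open import Data.Nat.Properties
  using ( +-comm; +-suc; +-identityʳ; *-suc; suc-injective; ≤-refl; ≤-reflexive; ≤-trans; ≤-antisym
        ; ≤-pred; n≤1+n; n<1+n; 1+n≰n; ≰⇒>; <⇒≱; <⇒≢; m≤m+n; m≤n+m; m≤n*m; m<m+n; m+1+n≢m
        ; *-monoʳ-≤; ∸-monoʳ-<; m≤o∸n⇒m+n≤o )
open import Data.Nat.ListAction using (sum)
open import Data.Parity.Base using (Parity; 0ℙ; 1ℙ)
open import Data.Parity.Properties using () renaming (_≟_ to _≟ᵖ_)
open import Data.Fin using (Fin; toℕ; fromℕ<)
open import Data.Fin.Properties using (toℕ-fromℕ<; toℕ<n; toℕ-injective) renaming (_≟_ to _≟ᶠ_)
open import Data.Bool using (true; false)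
open import Data.List using (List; []; _∷_; _++_; [_]; length; map)
open import Data.List.Properties
  using (∷ʳ-injectiveˡ; ∷ʳ-injectiveʳ; ∷-injective; ++-assoc; ++-identityʳ; length-++; ≡-dec)
open import Data.List.Membership.Propositional using (_∈_)
open import Data.List.Relation.Unary.Any using (here; there)
open import Data.List.Relation.Unary.All as All using (All; []; _∷_)
open import Data.List.Relation.Unary.AllPairs using ([]; _∷_)
open import Data.List.Relation.Unary.Unique.Propositional using (Unique)
open import Data.List.Relation.Unary.Unique.Propositional.Properties using (map⁻)
open import Data.List.Relation.Binary.Sublist.Propositional
  using (_⊆_; []; _∷_; _∷ʳ_; ⊆-refl; ⊆-trans; minimum; lookup)
open import Data.List.Relation.Binary.Sublist.Propositional.Properties using (All-resp-⊆; length-mono-≤)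
open import Relation.Binary.Construct.Closure.ReflexiveTransitive using (Star; ε; _◅_)
open import Data.Product using (Σ; _×_; _,_; proj₁; proj₂)
open import Data.Sum using (_⊎_; inj₁; inj₂)
open import Data.Empty using (⊥; ⊥-elim)
open import Function using (_∘_)
open import Relation.Nullary using (¬_; yes; no; ¬?)
open import Relation.Nullary.Decidable using (decidable-stable)
open import Relation.Unary using (Decidable)
open import Relation.Binary.PropositionalEquality hiding ([_])

Unique-⊆ : ∀ {A : Set} {xs ys : List A} → xs ⊆ ys → Unique ys → Unique xs
Unique-⊆ []          []         = []
Unique-⊆ (_ ∷ʳ τ)    (_ ∷ u)    = Unique-⊆ τ u
Unique-⊆ (refl ∷ τ)  (x∉ ∷ u)   = All-resp-⊆ τ x∉ ∷ Unique-⊆ τ u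

term≤sum : ∀ {A : Set} (f : A → ℕ) (xs : List A) → All (λ x → f x ≤ sum (map f xs)) xs
term≤sum f []       = []
term≤sum f (x ∷ xs) = m≤m+n (f x) _ ∷ All.map (λ le → ≤-trans le (m≤n+m _ (f x))) (term≤sum f xs)

module Crossings {A : Set} {R : A → A → Set} where

  nodes : ∀ {x y} → Star R x y → List A
  nodes {x} ε        = x ∷ []
  nodes {x} (_ ◅ rs) = x ∷ nodes rs

  data AnyStep (P : ∀ {u v} → R u v → Set) : ∀ {x y} → Star R x y → Set where
    here  : ∀ {x y z} {r : R x y} {rs : Star R y z} → P r → AnyStep P (r ◅ rs)
    there : ∀ {x y z} {r : R x y} {rs : Star R y z} → AnyStep P rs → AnyStep P (r ◅ rs)

  AnyStep-map : ∀ {P P′ : ∀ {u v} → R u v → Set} {x y} {rs : Star R x y} →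
                (∀ {u v} {r : R u v} → P r → P′ r) → AnyStep P rs → AnyStep P′ rs
  AnyStep-map f (here p)  = here (f p)
  AnyStep-map f (there p) = there (AnyStep-map f p)

  AnyStep-refine : ∀ {J : Set} {P : ∀ {u v} → R u v → Set} {P′ : J → ∀ {u v} → R u v → Set} {x y}
                   {rs : Star R x y} → (∀ {u v} (r : R u v) → P r → Σ J λ j → P′ j r) →
                   AnyStep P rs → Σ J λ j → AnyStep (P′ j) rs
  AnyStep-refine f (here {r = r} p) with f r p
  ... | j , p′ = j , here p′
  AnyStep-refine f (there p) with AnyStep-refine f p
  ... | j , p′ = j , there p′

  record StepWith (P : ∀ {u v} → R u v → Set) : Set where
    constructor stepWith
    field
      {from to} : A
      step      : R from to
      property  : P step

  open StepWith public

  locate : ∀ {P : ∀ {u v} → R u v → Set} {x y} {rs : Star R x y} →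
           AnyStep P rs → Σ (StepWith P) λ e → from e ∈ nodes rs
  locate (here {r = r} p) = stepWith r p , here refl
  locate (there p) with locate p
  ... | e , m = e , there m

  Into OutOf : (A → Set) → ∀ {u v} → R u v → Set
  Into  Q {u} {v} _ = ¬ Q u × Q v
  OutOf Q {u} {v} _ = Q u × ¬ Q v

  enters : ∀ {Q : A → Set} → Decidable Q → ∀ {x y} → ¬ Q x → Q y → (rs : Star R x y) →
           AnyStep (Into Q) rs
  enters Q? ¬qx qy ε = ⊥-elim (¬qx qy)
  enters Q? ¬qx qy (_◅_ {j = v} r rs) with Q? v
  ... | yes qv = here (¬qx , qv)
  ... | no ¬qv = there (enters Q? ¬qv qy rs)

  module _ {Q : A → Set} (Q? : Decidable Q) where

    leaves : ∀ {x y} → Q x → ¬ Q y → (rs : Star R x y) → AnyStep (OutOf Q) rs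
    leaves qx ¬qy rs = AnyStep-map (λ (¬¬qu , ¬qv) → decidable-stable (Q? _) ¬¬qu , ¬qv)
                                   (enters (λ u → ¬? (Q? u)) (λ ¬qx → ¬qx qx) ¬qy rs)

    reenters : ∀ {x y} {rs : Star R x y} → Q y → AnyStep (OutOf Q) rs →
               Σ (StepWith (Into Q)) λ e → from e ∈ nodes rs
    reenters qy (here {rs = rs} (_ , ¬qv)) with locate (enters Q? ¬qv qy rs)
    ... | e , m = e , there m
    reenters qy (there p) with reenters qy p
    ... | e , m = e , there m

    entersTwice : ∀ {x y} → ¬ Q x → Q y → (rs : Star R x y) → Unique (nodes rs) →
                  AnyStep (OutOf Q) rs →
                  Σ (StepWith (Into Q)) λ e₁ → Σ (StepWith (Into Q)) λ e₂ → from e₁ ≢ from e₂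
    entersTwice ¬qx qy (r ◅ rs) _ (here (qx , _)) = ⊥-elim (¬qx qx)
    entersTwice ¬qx qy (_◅_ {j = v} r rs) (x∉ ∷ u) (there p) with Q? v
    ... | no ¬qv = entersTwice ¬qv qy rs u p
    ... | yes qv with reenters qy p
    ...   | e , m = stepWith r (¬qx , qv) , e , All.lookup x∉ m

⌊2n/2⌋≡n : ∀ n → ⌊ 2 * n /2⌋ ≡ n
⌊2n/2⌋≡n zero    = refl
⌊2n/2⌋≡n (suc n) = trans (cong ⌊_/2⌋ (*-suc 2 n)) (cong suc (⌊2n/2⌋≡n n))

⌊1+2n/2⌋≡n : ∀ n → ⌊ suc (2 * n) /2⌋ ≡ n
⌊1+2n/2⌋≡n zero    = refl
⌊1+2n/2⌋≡n (suc n) = trans (cong (λ m → ⌊ suc m /2⌋) (*-suc 2 n)) (cong suc (⌊1+2n/2⌋≡n n))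

parity-2n : ∀ n → parity (2 * n) ≡ 0ℙ
parity-2n zero    = refl
parity-2n (suc n) = trans (cong parity (*-suc 2 n)) (parity-2n n)

parity-1+2n : ∀ n → parity (suc (2 * n)) ≡ 1ℙ
parity-1+2n zero    = refl
parity-1+2n (suc n) = trans (cong (λ m → parity (suc m)) (*-suc 2 n)) (parity-1+2n n)

⌊n+2/2⌋ : ∀ n → ⌊ n + 2 /2⌋ ≡ suc ⌊ n /2⌋
⌊n+2/2⌋ n = cong ⌊_/2⌋ (+-comm n 2)

parity-n+2 : ∀ n → parity (n + 2) ≡ parity n
parity-n+2 n = cong parity (+-comm n 2)

2k∸2≡2[k∸1] : ∀ {k} → 1 ≤ k → 2 * k ∸ 2 ≡ 2 * (k ∸ 1)
2k∸2≡2[k∸1] {suc m} _ = cong (_∸ 2) (*-suc 2 m)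

2k∸1≡1+2[k∸1] : ∀ {k} → 1 ≤ k → 2 * k ∸ 1 ≡ suc (2 * (k ∸ 1))
2k∸1≡1+2[k∸1] {suc m} _ = cong (_∸ 1) (*-suc 2 m)

1+[k∸1]≡k : ∀ {k} → 1 ≤ k → suc (k ∸ 1) ≡ k
1+[k∸1]≡k {suc m} _ = refl

⌊/2⌋-parity-injective : ∀ m n → ⌊ m /2⌋ ≡ ⌊ n /2⌋ → parity m ≡ parity n → m ≡ n
⌊/2⌋-parity-injective zero          zero          _ _ = refl
⌊/2⌋-parity-injective zero          (suc zero)    _ ()
⌊/2⌋-parity-injective zero          (suc (suc n)) () _
⌊/2⌋-parity-injective (suc zero)    zero          _ ()
⌊/2⌋-parity-injective (suc zero)    (suc zero)    _ _ = refl
⌊/2⌋-parity-injective (suc zero)    (suc (suc n)) () _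
⌊/2⌋-parity-injective (suc (suc m)) zero          () _
⌊/2⌋-parity-injective (suc (suc m)) (suc zero)    () _
⌊/2⌋-parity-injective (suc (suc m)) (suc (suc n)) h p =
  cong (λ x → suc (suc x)) (⌊/2⌋-parity-injective m n (suc-injective h) p)

parity-dichotomy : ∀ {p q : Parity} (r : Parity) → p ≢ q → r ≡ p ⊎ r ≡ q
parity-dichotomy {0ℙ} {0ℙ} _  p≢q = ⊥-elim (p≢q refl)
parity-dichotomy {1ℙ} {1ℙ} _  p≢q = ⊥-elim (p≢q refl)
parity-dichotomy {0ℙ} {1ℙ} 0ℙ _   = inj₁ refl
parity-dichotomy {0ℙ} {1ℙ} 1ℙ _   = inj₂ refl
parity-dichotomy {1ℙ} {0ℙ} 0ℙ _   = inj₂ refl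
parity-dichotomy {1ℙ} {0ℙ} 1ℙ _   = inj₁ refl

same-half : ∀ {m₁ m₂ m₃} → m₁ ≢ m₂ → ⌊ m₁ /2⌋ ≡ ⌊ m₃ /2⌋ → ⌊ m₂ /2⌋ ≡ ⌊ m₃ /2⌋ →
            m₃ ≡ m₁ ⊎ m₃ ≡ m₂
same-half {m₁} {m₂} {m₃} m₁≢m₂ h₁ h₂
  with parity-dichotomy (parity m₃)
         (λ p → m₁≢m₂ (⌊/2⌋-parity-injective m₁ m₂ (trans h₁ (sym h₂)) p))
... | inj₁ p = inj₁ (⌊/2⌋-parity-injective m₃ m₁ (sym h₁) p)
... | inj₂ p = inj₂ (⌊/2⌋-parity-injective m₃ m₂ (sym h₂) p)

module _ (k : ℕ) (hk : 2 ≤ k) where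

  source target : Arc k → Vertex k
  source = src k hk
  target = tgt k hk

  word : Vertex k → Word k
  word (s μ) = μ
  word (t μ) = μ

  data Local : Set where
    top-s top-t     : Local
    child-s child-t : I k → Local

  at : Word k → Local → Vertex k
  at μ top-s       = s μ
  at μ top-t       = t μ
  at μ (child-s i) = s (μ ++ [ i ])
  at μ (child-t i) = t (μ ++ [ i ])

  private
    2≤2k : 2 ≤ 2 * k
    2≤2k = ≤-trans hk (m≤n*m k 2)

    1+2m<2k : ∀ {m} → m < k → suc (2 * m) < 2 * k
    1+2m<2k {m} m<k = subst (_≤ 2 * k) (*-suc 2 m) (*-monoʳ-≤ 2 m<k)

    2m<2k : ∀ {m} → m < k → 2 * m < 2 * k
    2m<2k m<k = ≤-trans (n≤1+n _) (1+2m<2k m<k)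

    1+m<k : ∀ {m} → m < k ∸ 1 → suc m < k
    1+m<k {m} m<k∸1 = subst (_≤ k) (+-comm (suc m) 1) (m≤o∸n⇒m+n≤o (suc m) (≤-trans (s≤s z≤n) hk) m<k∸1)

    1+j<k : (j : Fin (k ∸ 1)) → suc (toℕ j) < k
    1+j<k j = 1+m<k (toℕ<n j)

  -- The indices of I = {0, …, 2k-1} occurring in the construction.  Since fromℕ< ignores
  -- its (irrelevant) proof argument, they agree definitionally with those used in Defs.
  i₀ i₁ i₂ₖ₋₂ i₂ₖ₋₁ : I k
  i₀    = fromℕ< {0} (≤-trans (s≤s z≤n) 2≤2k)
  i₁    = fromℕ< {1} 2≤2k
  i₂ₖ₋₂ = fromℕ< {2 * k ∸ 2} (∸-monoʳ-< {2 * k} {2} {0} (s≤s z≤n) 2≤2k)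
  i₂ₖ₋₁ = fromℕ< {2 * k ∸ 1} (∸-monoʳ-< {2 * k} {1} {0} (s≤s z≤n) (≤-trans (s≤s z≤n) 2≤2k))

  iᴮ i+2ᴮ : Fin (2 * k ∸ 2) → I k
  iᴮ   i = fromℕ< {toℕ i} (≤-trans (s≤s (m≤m+n (toℕ i) 2)) (m≤o∸n⇒m+n≤o (suc (toℕ i)) 2≤2k (toℕ<n i)))
  i+2ᴮ i = fromℕ< {toℕ i + 2} (m≤o∸n⇒m+n≤o (suc (toℕ i)) 2≤2k (toℕ<n i))

  2j 2j+1 : Fin k → I k
  2j   j = fromℕ< {2 * toℕ j} (2m<2k (toℕ<n j))
  2j+1 j = fromℕ< {suc (2 * toℕ j)} (1+2m<2k (toℕ<n j))

  2j+1ᵒ 2j+2ᵒ : Fin (k ∸ 1) → I k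
  2j+1ᵒ j = fromℕ< {suc (2 * toℕ j)} (1+2m<2k (≤-trans (n≤1+n _) (1+j<k j)))
  2j+2ᵒ j = fromℕ< {suc (suc (2 * toℕ j))} (subst (_< 2 * k) (*-suc 2 (toℕ j)) (2m<2k (1+j<k j)))

  gadget : Arc k → Word k
  gadget (pairA μ _ _)   = μ
  gadget (pairB μ _ _ _) = μ
  gadget (pairC μ _ _)   = μ
  gadget (arc1 μ)        = μ
  gadget (arc2 μ _)      = μ
  gadget (arc3 μ _)      = μ
  gadget (arc4 μ)        = μ

  lsrc ltgt : Arc k → Local
  lsrc (pairA _ _ true)    = top-s
  lsrc (pairA _ _ false)   = child-t i₁
  lsrc (pairB _ i _ true)  = child-s (iᴮ i)
  lsrc (pairB _ i _ false) = child-t (i+2ᴮ i)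
  lsrc (pairC _ _ true)    = child-s i₂ₖ₋₂
  lsrc (pairC _ _ false)   = top-t
  lsrc (arc1 _)            = top-s
  lsrc (arc2 _ j)          = child-t (2j j)
  lsrc (arc3 _ j)          = child-s (2j+1ᵒ j)
  lsrc (arc4 _)            = child-s i₂ₖ₋₁
  ltgt (pairA _ _ true)    = child-t i₁
  ltgt (pairA _ _ false)   = top-s
  ltgt (pairB _ i _ true)  = child-t (i+2ᴮ i)
  ltgt (pairB _ i _ false) = child-s (iᴮ i)
  ltgt (pairC _ _ true)    = top-t
  ltgt (pairC _ _ false)   = child-s i₂ₖ₋₂
  ltgt (arc1 _)            = child-t i₀
  ltgt (arc2 _ j)          = child-s (2j+1 j)
  ltgt (arc3 _ j)          = child-t (2j+2ᵒ j)
  ltgt (arc4 _)            = top-t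

  arc-local : ∀ a → source a ≡ at (gadget a) (lsrc a) × target a ≡ at (gadget a) (ltgt a)
  arc-local (pairA _ _ true)    = refl , refl
  arc-local (pairA _ _ false)   = refl , refl
  arc-local (pairB _ _ _ true)  = refl , refl
  arc-local (pairB _ _ _ false) = refl , refl
  arc-local (pairC _ _ true)    = refl , refl
  arc-local (pairC _ _ false)   = refl , refl
  arc-local (arc1 _)            = refl , refl
  arc-local (arc2 _ _)          = refl , refl
  arc-local (arc3 _ _)          = refl , refl
  arc-local (arc4 _)            = refl , refl

  half : I k → ℕ
  half i = ⌊ toℕ i /2⌋

  level : Local → ℕ
  level top-s       = 0
  level top-t       = k
  level (child-s i) = suc (half i)
  level (child-t i) = half i

  par : Local → Parity
  par top-s       = 1ℙ
  par top-t       = 0ℙ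
  par (child-s i) = parity (toℕ i)
  par (child-t i) = parity (toℕ i)

  data Shape (a : Arc k) : Set where
    flat-same : level (ltgt a) ≡ level (lsrc a) → par (lsrc a) ≡ par (ltgt a) → Shape a
    flat-odd  : level (ltgt a) ≡ level (lsrc a) → par (lsrc a) ≡ 1ℙ → Shape a
    rising    : (j : Fin k) → a ≡ arc2 (gadget a) j →
                level (lsrc a) ≡ toℕ j → level (ltgt a) ≡ suc (toℕ j) → Shape a

  private
    half-fromℕ< : ∀ m .(m<2k : m < 2 * k) → half (fromℕ< m<2k) ≡ ⌊ m /2⌋
    half-fromℕ< m m<2k = cong ⌊_/2⌋ (toℕ-fromℕ< m<2k)

    parity-fromℕ< : ∀ m .(m<2k : m < 2 * k) → parity (toℕ (fromℕ< m<2k)) ≡ parity m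
    parity-fromℕ< m m<2k = cong parity (toℕ-fromℕ< m<2k)

    1≤k : 1 ≤ k
    1≤k = ≤-trans (s≤s z≤n) hk

    level-2k-2 : suc (half i₂ₖ₋₂) ≡ k
    level-2k-2 = trans (cong suc (trans (half-fromℕ< (2 * k ∸ 2) _) (trans (cong ⌊_/2⌋ (2k∸2≡2[k∸1] 1≤k))
                                                              (⌊2n/2⌋≡n _))))
                       (1+[k∸1]≡k 1≤k)

    parity-2k-2 : parity (toℕ i₂ₖ₋₂) ≡ 0ℙ
    parity-2k-2 = trans (parity-fromℕ< (2 * k ∸ 2) _) (trans (cong parity (2k∸2≡2[k∸1] 1≤k)) (parity-2n (k ∸ 1)))

    level-2k-1 : suc (half i₂ₖ₋₁) ≡ k
    level-2k-1 = trans (cong suc (trans (half-fromℕ< (2 * k ∸ 1) _) (trans (cong ⌊_/2⌋ (2k∸1≡1+2[k∸1] 1≤k))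
                                                              (⌊1+2n/2⌋≡n _))))
                       (1+[k∸1]≡k 1≤k)

    parity-2k-1 : parity (toℕ i₂ₖ₋₁) ≡ 1ℙ
    parity-2k-1 = trans (parity-fromℕ< (2 * k ∸ 1) _) (trans (cong parity (2k∸1≡1+2[k∸1] 1≤k)) (parity-1+2n (k ∸ 1)))

    level-i+2 : ∀ i → half (i+2ᴮ i) ≡ suc (half (iᴮ i))
    level-i+2 i = trans (half-fromℕ< (toℕ i + 2) _) (trans (⌊n+2/2⌋ (toℕ i)) (cong suc (sym (half-fromℕ< (toℕ i) _))))

    parity-i+2 : ∀ i → parity (toℕ (iᴮ i)) ≡ parity (toℕ (i+2ᴮ i))
    parity-i+2 i = trans (parity-fromℕ< (toℕ i) _) (trans (sym (parity-n+2 (toℕ i))) (sym (parity-fromℕ< (toℕ i + 2) _)))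

    level-odd : ∀ j → suc (half (2j+1ᵒ j)) ≡ suc (toℕ j)
    level-odd j = cong suc (trans (half-fromℕ< (suc (2 * toℕ j)) _) (⌊1+2n/2⌋≡n _))

    level-even : ∀ j → half (2j+2ᵒ j) ≡ suc (toℕ j)
    level-even j = trans (half-fromℕ< (suc (suc (2 * toℕ j))) _) (cong suc (⌊2n/2⌋≡n _))

  shape : ∀ a → Shape a
  shape (pairA _ _ true)    = flat-odd (half-fromℕ< 1 _) refl
  shape (pairA _ _ false)   = flat-odd (sym (half-fromℕ< 1 _)) (parity-fromℕ< 1 _)
  shape (pairB _ i _ true)  = flat-same (level-i+2 i) (parity-i+2 i)
  shape (pairB _ i _ false) = flat-same (sym (level-i+2 i)) (sym (parity-i+2 i))
  shape (pairC _ _ true)    = flat-same (sym level-2k-2) parity-2k-2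
  shape (pairC _ _ false)   = flat-same level-2k-2 (sym parity-2k-2)
  shape (arc1 _)            = flat-odd (half-fromℕ< 0 _) refl
  shape (arc2 _ j)          = rising j refl (trans (half-fromℕ< (2 * toℕ j) _) (⌊2n/2⌋≡n _))
                                            (cong suc (trans (half-fromℕ< (suc (2 * toℕ j)) _) (⌊1+2n/2⌋≡n _)))
  shape (arc3 _ j)          = flat-odd (trans (level-even j) (sym (level-odd j)))
                                       (trans (parity-fromℕ< (suc (2 * toℕ j)) _) (parity-1+2n (toℕ j)))
  shape (arc4 _)            = flat-odd (sym level-2k-1) parity-2k-1

  data Near (g : Word k) : Word k → Set where
    self  : Near g g
    child : ∀ i → Near g (g ++ [ i ])

  near-at : ∀ g x → Near g (word (at g x))
  near-at g top-s       = self
  near-at g top-t       = self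
  near-at g (child-s i) = child i
  near-at g (child-t i) = child i

  near-source : ∀ a → Near (gadget a) (word (source a))
  near-source a with arc-local a
  ... | e , _ = subst (Near (gadget a)) (cong word (sym e)) (near-at (gadget a) (lsrc a))

  near-target : ∀ a → Near (gadget a) (word (target a))
  near-target a with arc-local a
  ... | _ , e = subst (Near (gadget a)) (cong word (sym e)) (near-at (gadget a) (ltgt a))

  longer : ∀ {xs ys : Word k} {y zs} → length xs ≡ length ys → xs ≢ ys ++ y ∷ zs
  longer {xs} {ys} |xs|≡|ys| e =
    m+1+n≢m (length ys) (sym (trans (sym |xs|≡|ys|) (trans (cong length e) (length-++ ys))))

  |μi|≡|μj| : ∀ μ {i j : I k} → length (μ ++ [ i ]) ≡ length (μ ++ [ j ])
  |μi|≡|μj| μ = trans (length-++ μ) (sym (length-++ μ))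

  μ≢μi : ∀ μ {i : I k} → μ ≢ μ ++ [ i ]
  μ≢μi μ = longer refl

  letters-differ : ∀ μ {m n} .{m<2k : m < 2 * k} .{n<2k : n < 2 * k} → m ≢ n →
                   μ ++ [ fromℕ< m<2k ] ≢ μ ++ [ fromℕ< n<2k ]
  letters-differ μ {m<2k = m<2k} {n<2k} m≢n e =
    m≢n (trans (sym (toℕ-fromℕ< m<2k)) (trans (cong toℕ (∷ʳ-injectiveʳ μ μ e)) (toℕ-fromℕ< n<2k)))

  arc-words-differ : ∀ a → word (source a) ≢ word (target a)
  arc-words-differ (pairA μ _ true)    = μ≢μi μ
  arc-words-differ (pairA μ _ false)   = μ≢μi μ ∘ sym
  arc-words-differ (pairB μ i _ true)  = letters-differ μ (<⇒≢ (m<m+n (toℕ i) (s≤s z≤n)))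
  arc-words-differ (pairB μ i _ false) = letters-differ μ (<⇒≢ (m<m+n (toℕ i) (s≤s z≤n)) ∘ sym)
  arc-words-differ (pairC μ _ true)    = μ≢μi μ ∘ sym
  arc-words-differ (pairC μ _ false)   = μ≢μi μ
  arc-words-differ (arc1 μ)            = μ≢μi μ
  arc-words-differ (arc2 μ j)          = letters-differ μ (<⇒≢ (n<1+n _))
  arc-words-differ (arc3 μ j)          = letters-differ μ (<⇒≢ (n<1+n _))
  arc-words-differ (arc4 μ)            = μ≢μi μ ∘ sym

  Below : Word k → Vertex k → Set
  Below ν v = Σ (Word k) λ ρ → word v ≡ ν ++ ρ

  Inside : Word k → Vertex k → Set
  Inside ν v = Σ (I k) λ d → Σ (Word k) λ ρ → word v ≡ ν ++ d ∷ ρ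

  snoc-prefix : ∀ (xs ys : Word k) {i d ρ} → xs ++ [ i ] ≡ ys ++ d ∷ ρ → Σ (Word k) λ ν → xs ≡ ys ++ ν
  snoc-prefix xs       []             _  = xs , refl
  snoc-prefix []       (_ ∷ [])       ()
  snoc-prefix []       (_ ∷ _ ∷ _)    ()
  snoc-prefix (x ∷ xs) (y ∷ ys)       e with ∷-injective e
  ... | refl , e′ with snoc-prefix xs ys e′
  ...   | ν , xs≡ = ν , cong (x ∷_) xs≡

  gadget-below : ∀ {g w ν d ρ} → Near g w → w ≡ ν ++ d ∷ ρ → Σ (Word k) λ ν′ → g ≡ ν ++ ν′
  gadget-below self      e = _ , e
  gadget-below {g} {ν = ν} (child i) e = snoc-prefix g ν e

  near-below : ∀ {g w ν ν′} → Near g w → g ≡ ν ++ ν′ → Σ (Word k) λ ρ → w ≡ ν ++ ρ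
  near-below self      e = _ , e
  near-below {ν = ν} {ν′} (child i) e = ν′ ++ [ i ] , trans (cong (_++ [ i ]) e) (++-assoc ν ν′ [ i ])

  arc-stays-below : ∀ a {ν} → Inside ν (source a) → Below ν (target a)
  arc-stays-below a (_ , _ , e) with gadget-below (near-source a) e
  ... | _ , g≡ = near-below (near-target a) g≡

  no-shortcut : ∀ {g w₁ w₂ ρ} → Near g w₁ → Near g w₂ → w₁ ≢ w₂ → w₂ ≡ w₁ ++ ρ → g ≡ w₁
  no-shortcut self      _          _     _ = refl
  no-shortcut {g} {ρ = ρ} (child i) self _ e = ⊥-elim (longer refl (trans e (++-assoc g [ i ] ρ)))
  no-shortcut {ρ = []}    (child i) (child j) w₁≢w₂ e = ⊥-elim (w₁≢w₂ (sym (trans e (++-identityʳ _))))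
  no-shortcut {g} {ρ = _ ∷ _} (child i) (child j) _ e = ⊥-elim (longer (|μi|≡|μj| g) e)

  leave-root : ∀ a {μ} → word (source a) ≡ μ → Below μ (target a) → gadget a ≡ μ
  leave-root a {μ} w≡μ (ρ , e) =
    trans (no-shortcut (near-source a) (near-target a) (arc-words-differ a)
                       (trans e (cong (_++ ρ) (sym w≡μ))))
          w≡μ

  into-child : ∀ {g w₁ w₂ μ c} → Near g w₁ → Near g w₂ → w₁ ≢ w₂ → w₁ ≡ μ ++ [ c ] → g ≢ μ →
               Σ (I k) λ d → w₂ ≡ w₁ ++ [ d ]
  into-child self      self      w₁≢w₂ _ _   = ⊥-elim (w₁≢w₂ refl)
  into-child self      (child d) _     _ _   = d , refl
  into-child {g} {μ = μ} (child i) _ _ e g≢μ = ⊥-elim (g≢μ (∷ʳ-injectiveˡ g μ e))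

  enter-child : ∀ a {μ c} → word (source a) ≡ μ ++ [ c ] → gadget a ≢ μ → Inside (μ ++ [ c ]) (target a)
  enter-child a w≡ g≢μ with into-child (near-source a) (near-target a) (arc-words-differ a) w≡ g≢μ
  ... | d , e = d , [] , trans e (cong (_++ [ d ]) w≡)

  shallow : ∀ μ {c} x → ¬ Inside (μ ++ [ c ]) (at μ x)
  shallow μ {c} top-s       (d , ρ , e) = longer refl (trans e (++-assoc μ [ c ] (d ∷ ρ)))
  shallow μ {c} top-t       (d , ρ , e) = longer refl (trans e (++-assoc μ [ c ] (d ∷ ρ)))
  shallow μ     (child-s i) (_ , _ , e) = longer (|μi|≡|μj| μ) e
  shallow μ     (child-t i) (_ , _ , e) = longer (|μi|≡|μj| μ) e

  vertex-of-word : ∀ v {w} → word v ≡ w → v ≡ s w ⊎ v ≡ t w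
  vertex-of-word (s _) refl = inj₁ refl
  vertex-of-word (t _) refl = inj₂ refl

  at-injective : ∀ μ {x y} → at μ x ≡ at μ y → x ≡ y
  at-injective μ {top-s}     {top-s}     _ = refl
  at-injective μ {top-t}     {top-t}     _ = refl
  at-injective μ {child-s i} {child-s j} e = cong child-s (∷ʳ-injectiveʳ μ μ (cong word e))
  at-injective μ {child-t i} {child-t j} e = cong child-t (∷ʳ-injectiveʳ μ μ (cong word e))
  at-injective μ {top-s}     {child-s j} e = ⊥-elim (μ≢μi μ (cong word e))
  at-injective μ {top-t}     {child-t j} e = ⊥-elim (μ≢μi μ (cong word e))
  at-injective μ {child-s i} {top-s}     e = ⊥-elim (μ≢μi μ (sym (cong word e)))
  at-injective μ {child-t i} {top-t}     e = ⊥-elim (μ≢μi μ (sym (cong word e)))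
  at-injective μ {top-s}     {top-t}     ()
  at-injective μ {top-s}     {child-t j} ()
  at-injective μ {top-t}     {top-s}     ()
  at-injective μ {top-t}     {child-s j} ()
  at-injective μ {child-s i} {top-t}     ()
  at-injective μ {child-s i} {child-t j} ()
  at-injective μ {child-t i} {top-s}     ()
  at-injective μ {child-t i} {child-s j} ()

  verts : ∀ {u v} → Walk k hk u v → List (Vertex k)
  verts = vertices k hk

  arcsOf : ∀ {u v} → Walk k hk u v → List (Arc k)
  arcsOf = arcs k hk

  _++ʷ_ : ∀ {u v w} → Walk k hk u v → Walk k hk v w → Walk k hk u w
  []      ++ʷ W = W
  (a ∷ V) ++ʷ W = a ∷ (V ++ʷ W)

  start∈ : ∀ {u v} (W : Walk k hk u v) → u ∈ verts W
  start∈ []      = here refl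
  start∈ (_ ∷ _) = here refl

  verts-prefix : ∀ {u v w} (V : Walk k hk u v) (W : Walk k hk v w) → verts V ⊆ verts (V ++ʷ W)
  verts-prefix []      []      = ⊆-refl
  verts-prefix []      (_ ∷ _) = refl ∷ minimum _
  verts-prefix (_ ∷ V) W       = refl ∷ verts-prefix V W

  verts-suffix : ∀ {u v w} (V : Walk k hk u v) (W : Walk k hk v w) → verts W ⊆ verts (V ++ʷ W)
  verts-suffix []      W = ⊆-refl
  verts-suffix (a ∷ V) W = _ ∷ʳ verts-suffix V W

  arcs-prefix : ∀ {u v w} (V : Walk k hk u v) (W : Walk k hk v w) → arcsOf V ⊆ arcsOf (V ++ʷ W)
  arcs-prefix []      W = minimum _
  arcs-prefix (_ ∷ V) W = refl ∷ arcs-prefix V W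

  arcs-suffix : ∀ {u v w} (V : Walk k hk u v) (W : Walk k hk v w) → arcsOf W ⊆ arcsOf (V ++ʷ W)
  arcs-suffix []      W = ⊆-refl
  arcs-suffix (a ∷ V) W = a ∷ʳ arcs-suffix V W

  -- A walk that starts strictly below ν and ends outside that subtree first returns to a
  -- vertex with word ν; up to there it stays below ν, since arcs cannot skip over ν.
  data Exit (ν : Word k) {u v} : Walk k hk u v → Set where
    exit : ∀ {v′} (V : Walk k hk u v′) (W : Walk k hk v′ v) →
           word v′ ≡ ν → All (Below ν) (verts V) → Exit ν (V ++ʷ W)

  exits : ∀ {ν u v} (W : Walk k hk u v) → Inside ν u → ¬ Inside ν v → Exit ν W
  exits []      inside-u ¬inside-v = ⊥-elim (¬inside-v inside-u)
  exits (a ∷ W) (d , ρ , e) ¬inside-v with arc-stays-below a (d , ρ , e)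
  ... | [] , e′ = exit (a ∷ []) W (trans e′ (++-identityʳ _)) ((d ∷ ρ , e) ∷ ([] , e′) ∷ [])
  ... | d′ ∷ ρ′ , e′ with exits W (d′ , ρ′ , e′) ¬inside-v
  ...   | exit V W′ w≡ below = exit (a ∷ V) W′ w≡ ((d ∷ ρ , e) ∷ below)

  -- A walk that is part of an ambient walk with vertex list Vs and arc list As
  -- (in order, so it inherits the absence of repeated vertices) and stays below ν.
  record Within (Vs : List (Vertex k)) (As : List (Arc k)) (ν : Word k) {u v} (W : Walk k hk u v) : Set where
    constructor within
    field
      verts⊆ : verts W ⊆ Vs
      arcs⊆  : arcsOf W ⊆ As
      below  : All (Below ν) (verts W)

  module _ {Vs : List (Vertex k)} {As : List (Arc k)} where

    within-suffix : ∀ {ν u v w} (V : Walk k hk u v) (W : Walk k hk v w) →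
                    Within Vs As ν (V ++ʷ W) → Within Vs As ν W
    within-suffix V W (within vs⊆ as⊆ below) =
      within (⊆-trans (verts-suffix V W) vs⊆) (⊆-trans (arcs-suffix V W) as⊆) (All-resp-⊆ (verts-suffix V W) below)

    within-prefix : ∀ {μ ν u v w} (V : Walk k hk u v) (W : Walk k hk v w) →
                    Within Vs As μ (V ++ʷ W) → All (Below ν) (verts V) → Within Vs As ν V
    within-prefix V W (within vs⊆ as⊆ _) below =
      within (⊆-trans (verts-prefix V W) vs⊆) (⊆-trans (arcs-prefix V W) as⊆) below

  record Route (Vs : List (Vertex k)) (As : List (Arc k)) (ν : Word k) (u v : Vertex k) : Set where
    constructor route
    field
      {from to} : Vertex k
      walk      : Walk k hk from to
      from≡     : from ≡ u
      to≡       : to ≡ v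
      inside    : Within Vs As ν walk

  route-start∈ : ∀ {Vs As ν u v} → Route Vs As ν u v → u ∈ Vs
  route-start∈ (route W refl _ w) = lookup (Within.verts⊆ w) (start∈ W)

  module GadgetPaths (Vs : List (Vertex k)) (As : List (Arc k)) (μ : Word k) where

    Down Up : I k → Set
    Down c = Route Vs As (μ ++ [ c ]) (s (μ ++ [ c ])) (t (μ ++ [ c ]))
    Up   c = Route Vs As (μ ++ [ c ]) (t (μ ++ [ c ])) (s (μ ++ [ c ]))

    data Hop : Local → Local → Set where
      arc  : (a : Arc k) → gadget a ≡ μ → a ∈ As → Hop (lsrc a) (ltgt a)
      down : (c : I k) → Down c → Hop (child-s c) (child-t c)
      up   : (c : I k) → Up c → Hop (child-t c) (child-s c)

    open Crossings {R = Hop} public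

    private
      word-at-child : ∀ {x c} → (x ≡ child-s c ⊎ x ≡ child-t c) → word (at μ x) ≡ μ ++ [ c ]
      word-at-child (inj₁ refl) = refl
      word-at-child (inj₂ refl) = refl

      start-below : ∀ {ν u v} (W : Walk k hk u v) → All (Below ν) (verts W) → Below ν u
      start-below W below = All.lookup below (start∈ W)

    entry : ∀ a {x} → source a ≡ at μ x → gadget a ≢ μ → Below μ (target a) →
            Σ (I k) λ c → (x ≡ child-s c ⊎ x ≡ child-t c) × Inside (μ ++ [ c ]) (target a)
    entry a {top-s}     u≡ g≢μ below = ⊥-elim (g≢μ (leave-root a (cong word u≡) below))
    entry a {top-t}     u≡ g≢μ below = ⊥-elim (g≢μ (leave-root a (cong word u≡) below))
    entry a {child-s c} u≡ g≢μ _     = c , inj₁ refl , enter-child a (cong word u≡) g≢μ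
    entry a {child-t c} u≡ g≢μ _     = c , inj₂ refl , enter-child a (cong word u≡) g≢μ

    through : ∀ {c x v′} → (x ≡ child-s c ⊎ x ≡ child-t c) → word v′ ≡ μ ++ [ c ] → v′ ≢ at μ x →
              Route Vs As (μ ++ [ c ]) (at μ x) v′ → Σ Local λ y → Hop x y × v′ ≡ at μ y
    through {v′ = v′} side w≡ v′≢x R with side | vertex-of-word v′ w≡
    ... | inj₁ refl | inj₁ refl = ⊥-elim (v′≢x refl)
    ... | inj₁ refl | inj₂ refl = _ , down _ R , refl
    ... | inj₂ refl | inj₁ refl = _ , up _ R , refl
    ... | inj₂ refl | inj₂ refl = ⊥-elim (v′≢x refl)

    data Passage (a : Arc k) (x : Local) {v} : Walk k hk (target a) v → Set where
      passage : ∀ {v′ y} (V : Walk k hk (target a) v′) (W : Walk k hk v′ v) →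
                Hop x y → v′ ≡ at μ y → Passage a x (V ++ʷ W)

    passage-through-child : ∀ a {x y v} (W : Walk k hk (target a) v) → source a ≡ at μ x → v ≡ at μ y →
                            gadget a ≢ μ → Unique (verts (a ∷ W)) → Within Vs As μ (a ∷ W) → Passage a x W
    passage-through-child a {x} {y} W u≡ v≡ g≢μ (a∉ ∷ _) w@(within _ _ (_ ∷ below))
      with entry a u≡ g≢μ (start-below W below)
    ... | c , side , inside with exits W inside (λ inside-v → shallow μ y (subst (Inside _) v≡ inside-v))
    ... | exit {v′} V W′ w≡ below-c
      with through side w≡ v′≢x (route (a ∷ V) u≡ refl (within-prefix (a ∷ V) W′ w (source-below ∷ below-c)))
      where
      -- the walk returns to the other one of s_μc, t_μc, as it is simple
      v′≢x : v′ ≢ at μ x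
      v′≢x v′≡ = All.lookup a∉ (lookup (verts-suffix V W′) (start∈ W′)) (trans u≡ (sym v′≡))
      source-below : Below (μ ++ [ c ]) (source a)
      source-below = [] , trans (cong word u≡) (trans (word-at-child side) (sym (++-identityʳ _)))
    ... | _ , hop , v′≡ = passage V W′ hop v′≡

    decompose : ∀ n {u v} (W : Walk k hk u v) {x y} → u ≡ at μ x → v ≡ at μ y → length (arcsOf W) ≤ n →
                Unique (verts W) → Within Vs As μ W → Σ (Star Hop x y) λ G → map (at μ) (nodes G) ⊆ verts W
    decompose n [] u≡ v≡ _ _ _ with at-injective μ (trans (sym u≡) v≡)
    ... | refl = ε , sym u≡ ∷ []
    decompose (suc n) (a ∷ W) u≡ v≡ (s≤s len) uniq@(_ ∷ uniq′) w with ≡-dec _≟ᶠ_ (gadget a) μ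
    ... | yes refl with at-injective μ (trans (sym (proj₁ (arc-local a))) u≡)
    ...   | refl with decompose n W (proj₂ (arc-local a)) v≡ len uniq′ (within-suffix (a ∷ []) W w)
    ...     | G , G⊆ = arc a refl (lookup (Within.arcs⊆ w) (here refl)) ◅ G , sym u≡ ∷ G⊆
    decompose (suc n) (a ∷ W) u≡ v≡ (s≤s len) uniq@(_ ∷ uniq′) w | no g≢μ
      with passage-through-child a W u≡ v≡ g≢μ uniq w
    ... | passage V W′ hop v′≡
      with decompose n W′ v′≡ v≡ (≤-trans (length-mono-≤ (arcs-suffix V W′)) len)
                     (Unique-⊆ (verts-suffix V W′) uniq′) (within-suffix V W′ (within-suffix (a ∷ []) _ w))
    ...   | G , G⊆ = hop ◅ G , sym u≡ ∷ ⊆-trans G⊆ (verts-suffix V W′)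

    gadget-path : Unique Vs → ∀ {x y} → Route Vs As μ (at μ x) (at μ y) →
                  Σ (Star Hop x y) λ G → Unique (nodes G)
    gadget-path uniq (route W u≡ v≡ w) with decompose _ W u≡ v≡ ≤-refl (Unique-⊆ (Within.verts⊆ w) uniq) w
    ... | G , G⊆ = G , map⁻ (Unique-⊆ (⊆-trans G⊆ (Within.verts⊆ w)) uniq)

    Low : ℕ → Local → Set
    Low j x = level x ≤ j

    low? : ∀ j → Decidable (Low j)
    low? j x = level x ≤? j

    Odd : Local → Set
    Odd x = par x ≡ 1ℙ

    odd? : Decidable Odd
    odd? x = par x ≟ᵖ 1ℙ

    arc-level-mono : ∀ a → level (lsrc a) ≤ level (ltgt a)
    arc-level-mono a with shape a
    ... | flat-same l _      = ≤-reflexive (sym l)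
    ... | flat-odd  l _      = ≤-reflexive (sym l)
    ... | rising _ _ ls lt   = ≤-trans (≤-reflexive ls) (≤-trans (n≤1+n _) (≤-reflexive (sym lt)))

    hop-descends : ∀ {j x y} (h : Hop x y) → Into (Low j) h →
                   Σ (I k) λ c → x ≡ child-s c × half c ≡ j × Down c
    hop-descends (arc a _ _) (¬low-x , low-y) = ⊥-elim (¬low-x (≤-trans (arc-level-mono a) low-y))
    hop-descends (down c R)  (¬low-x , low-y) = c , refl , ≤-antisym low-y (≤-pred (≰⇒> ¬low-x)) , R
    hop-descends (up c R)    (¬low-x , low-y) = ⊥-elim (¬low-x (≤-trans (n≤1+n _) low-y))

    hop-ascends : ∀ {j x y} (h : Hop x y) → OutOf (Low j) h →
                  (Σ (Fin k) λ j′ → toℕ j′ ≡ j × arc2 μ j′ ∈ As) ⊎ (Σ (I k) λ c → half c ≡ j × Up c)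
    hop-ascends (arc a g≡μ a∈) (low-x , ¬low-y) with shape a
    ... | flat-same l _ = ⊥-elim (¬low-y (subst (_≤ _) (sym l) low-x))
    ... | flat-odd  l _ = ⊥-elim (¬low-y (subst (_≤ _) (sym l) low-x))
    ... | rising j′ a≡ ls lt =
      inj₁ (j′ , ≤-antisym (subst (_≤ _) ls low-x) (≤-pred (subst (_ <_) lt (≰⇒> ¬low-y))) ,
            subst (_∈ As) (trans a≡ (cong (λ g → arc2 g j′) g≡μ)) a∈)
    hop-ascends (down c R) (low-x , ¬low-y) = ⊥-elim (¬low-y (≤-trans (n≤1+n _) low-x))
    hop-ascends (up c R)   (low-x , ¬low-y) = inj₂ (c , ≤-antisym low-x (≤-pred (≰⇒> ¬low-y)) , R)

    hop-turns-odd : ∀ {x y} (h : Hop x y) → Into Odd h →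
                    Σ (Fin k) λ j → arc2 μ j ∈ As × OutOf (Low (toℕ j)) h
    hop-turns-odd (arc a g≡μ a∈) (¬odd-x , odd-y) with shape a
    ... | flat-same _ p = ⊥-elim (¬odd-x (trans p odd-y))
    ... | flat-odd  _ p = ⊥-elim (¬odd-x p)
    ... | rising j a≡ ls lt =
      j , subst (_∈ As) (trans a≡ (cong (λ g → arc2 g j) g≡μ)) a∈ ,
      ≤-reflexive ls , λ low-y → 1+n≰n (subst (_≤ toℕ j) lt low-y)
    hop-turns-odd (down c _) (¬odd-x , odd-y) = ⊥-elim (¬odd-x odd-y)
    hop-turns-odd (up c _)   (¬odd-x , odd-y) = ⊥-elim (¬odd-x odd-y)

    record TwoDescents (j : ℕ) : Set where
      field
        {c₁ c₂}  : I k
        distinct : c₁ ≢ c₂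
        level₁   : half c₁ ≡ j
        level₂   : half c₂ ≡ j
        route₁   : Down c₁
        route₂   : Down c₂

    -- A simple gadget path from t_μ (level k, even) to s_μ (level 0, odd) turns odd at an
    -- arc (t_μ2j, s_μ(2j+1)); as it leaves level ≤ j there but starts and ends on the
    -- other sides of it, it descends to level ≤ j twice, through two children.
    must-dip : (G : Star Hop top-t top-s) → Unique (nodes G) →
               Σ (Fin k) λ j → arc2 μ j ∈ As × TwoDescents (toℕ j)
    must-dip G uniq with AnyStep-refine hop-turns-odd (enters odd? (λ ()) refl G)
    ... | j , turn with locate turn | entersTwice (low? (toℕ j)) (<⇒≱ (toℕ<n j)) z≤n G uniq (AnyStep-map proj₂ turn)
    ... | stepWith _ (arc2∈ , _) , _ | stepWith h₁ e₁ , stepWith h₂ e₂ , from≢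
      with hop-descends h₁ e₁ | hop-descends h₂ e₂
    ... | c₁ , refl , l₁ , R₁ | c₂ , refl , l₂ , R₂ =
      j , arc2∈ , record { distinct = λ c₁≡c₂ → from≢ (cong child-s c₁≡c₂)
                         ; level₁ = l₁ ; level₂ = l₂ ; route₁ = R₁ ; route₂ = R₂ }

    must-climb : Star Hop top-s top-t → ∀ j → j < k →
                 (Σ (Fin k) λ j′ → toℕ j′ ≡ j × arc2 μ j′ ∈ As) ⊎ (Σ (I k) λ c → half c ≡ j × Up c)
    must-climb G j j<k with locate (leaves (low? j) z≤n (<⇒≱ j<k) G)
    ... | stepWith h out , _ = hop-ascends h out

  -- Opposite gadget paths with disjoint arcs force a child to carry opposite routes:
  -- the path from t_μ dips through two children at some level j via the arc
  -- (t_μ2j, s_μ(2j+1)), which the path from s_μ cannot use, so it climbs through a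
  -- child at level j, which is one of the two.
  module _ {VsP VsQ : List (Vertex k)} {AsP AsQ : List (Arc k)}
           (disjoint : ∀ a → a ∈ AsP → a ∈ AsQ → ⊥) (μ : Word k) where

    private
      module GP = GadgetPaths VsP AsP μ
      module GQ = GadgetPaths VsQ AsQ μ

    child-conflict : Star GP.Hop top-s top-t → (G : Star GQ.Hop top-t top-s) → Unique (GQ.nodes G) →
                     Σ (I k) λ c → GQ.Down c × GP.Up c
    child-conflict GP GQ uniq with GQ.must-dip GQ uniq
    ... | j , arc2∈Q , two with GP.must-climb GP (toℕ j) (toℕ<n j)
    ... | inj₁ (j′ , j′≡j , arc2∈P) =
      ⊥-elim (disjoint _ (subst (λ i → arc2 μ i ∈ AsP) (toℕ-injective j′≡j) arc2∈P) arc2∈Q)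
    ... | inj₂ (c , l , R) with same-half (distinct ∘ toℕ-injective) (trans level₁ (sym l)) (trans level₂ (sym l))
      where open GQ.TwoDescents two
    ... | inj₁ c≡c₁ = c , subst GQ.Down (sym (toℕ-injective c≡c₁)) (GQ.TwoDescents.route₁ two) , R
    ... | inj₂ c≡c₂ = c , subst GQ.Down (sym (toℕ-injective c≡c₂)) (GQ.TwoDescents.route₂ two) , R

    opposite-routes-in-child : Unique VsP → Unique VsQ →
                               Route VsP AsP μ (s μ) (t μ) → Route VsQ AsQ μ (t μ) (s μ) →
                               Σ (I k) λ c → GQ.Down c × GP.Up c
    opposite-routes-in-child uniqP uniqQ RP RQ =
      child-conflict (proj₁ (GP.gadget-path uniqP {top-s} {top-t} RP)) (proj₁ pathQ) (proj₂ pathQ)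
      where
      pathQ = GQ.gadget-path uniqQ {top-t} {top-s} RQ

  |μc| : ∀ (μ : Word k) (c : I k) → length (μ ++ [ c ]) ≡ suc (length μ)
  |μc| μ c = trans (length-++ μ) (+-comm (length μ) 1)

  -- Infinite descent: opposite routes with disjoint arcs below μ yield opposite routes,
  -- with the roles of the ambient walks exchanged, below a child of μ.  This is
  -- impossible once the words exceed a bound B on the word lengths in both ambient walks.
  module Descent (B : ℕ) where

    Ambient : List (Vertex k) → Set
    Ambient Vs = Unique Vs × All (λ v → length (word v) ≤ B) Vs

    no-opposite-routes : ∀ n μ {Vs₁ Vs₂ As₁ As₂} → Ambient Vs₁ → Ambient Vs₂ →
                         (∀ a → a ∈ As₁ → a ∈ As₂ → ⊥) → B ≤ length μ + n →
                         Route Vs₁ As₁ μ (s μ) (t μ) → Route Vs₂ As₂ μ (t μ) (s μ) → ⊥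
    no-opposite-routes zero μ (uniq₁ , _) (uniq₂ , bounded₂) disjoint B≤ R₁ R₂ =
      let c , R₂′ , _ = opposite-routes-in-child disjoint μ uniq₁ uniq₂ R₁ R₂
      in 1+n≰n (≤-trans (≤-trans (≤-reflexive (sym (|μc| μ c))) (All.lookup bounded₂ (route-start∈ R₂′)))
                        (subst (B ≤_) (+-identityʳ (length μ)) B≤))
    no-opposite-routes (suc n) μ amb₁ amb₂ disjoint B≤ R₁ R₂ =
      let c , R₂′ , R₁′ = opposite-routes-in-child disjoint μ (proj₁ amb₁) (proj₁ amb₂) R₁ R₂
      in no-opposite-routes n (μ ++ [ c ]) amb₂ amb₁ (λ a a∈₂ a∈₁ → disjoint a a∈₁ a∈₂)
           (subst (B ≤_) (trans (+-suc (length μ) n) (cong (_+ n) (sym (|μc| μ c)))) B≤) R₂′ R₁′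

whole-route : ∀ {k hk u v} (W : Walk k hk u v) → Route k hk (verts k hk W) (arcsOf k hk W) [] u v
whole-route {k} {hk} W = route W refl refl (within ⊆-refl ⊆-refl (All.tabulate (λ {v} _ → word k hk v , refl)))

word-size : ∀ {k hk u v} → Walk k hk u v → ℕ
word-size {k} {hk} W = sum (map (length ∘ word k hk) (verts k hk W))

word-size-bound : ∀ {k hk u v} (W : Walk k hk u v) {B} → word-size W ≤ B →
                  All (λ v → length (word k hk v) ≤ B) (verts k hk W)
word-size-bound {k} {hk} W ≤B = All.map (λ le → ≤-trans le ≤B) (term≤sum _ (verts k hk W))

-- The theorem: P and Q are opposite routes below the root, inside ambient walks whose
-- words have length at most B, the total word length along P and Q; so the descent
-- from the root, with B levels to spare, excludes them.
lemma2 : (k : ℕ) (hk : 2 ≤ k) →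
    ¬ (Σ (Walk k hk (s []) (t [])) λ p → Σ (Walk k hk (t []) (s [])) λ q →
    IsPath k hk p × IsPath k hk q × EdgeDisjoint k hk p q)
lemma2 k hk (P , Q , uniqP , uniqQ , disjoint) =
  no-opposite-routes B [] (uniqP , word-size-bound P (m≤m+n _ _)) (uniqQ , word-size-bound Q (m≤n+m _ _))
                     disjoint ≤-refl (whole-route P) (whole-route Q)
  where
  B : ℕ
  B = word-size P + word-size Q
  open Descent k hk B
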